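{- Let $D$ be a (directed) graph with $n$ vertices and $f(D)=f$, let $R\subseteq V(D)$ be a bad set of $D$, and let $r'\in V(D)\setminus R$. Then there is a family $(D_i)_{i\in \mathbb{N}}$ of (directed) graphs such that for every $i$: $n(D_i)=n+i(n-1)$; $f(D_i)\geq f+if$, with equality when $R$ is inclusion-wise minimal among bad sets of $D$; and $\mathrm{deg}(D_i)\leq\mathrm{deg}_{\mathrm{RL}}(D,R,r')$.
   Context: All graphs are finite and simple; directed graphs are oriented graphs (no loops, multiple arcs or antiparallel arcs). A feedback vertex set of a (directed) graph is a vertex set whose deletion leaves no (directed) cycle; $f(G)$ is the minimum size of a feedback vertex set, $n(G)$ the number of vertices. A set $R$ of vertices is bad if it is not contained in any minimum feedback vertex set. For a graph $G=(V,E)$, an ordering $\phi:V\to[|V|]$ (a bijection) is a $k$-elimination ordering if every vertex $v$ has at most $k$ neighbours $u$ with $\phi(u)<\phi(v)$; $\mathrm{deg}(G)$, the degeneracy, is the least $k$ such that $G$ has a $k$-elimination ordering (for a directed graph, of its underlying undirected graph). For $S\subseteq V$, an ordering $\phi$ is $S$-last if $\phi(u)<\phi(v)$ for all $u\in S$ and $v\in V\setminus S$. Given $D$, a bad set $R$ and $r'\in V(D)\setminus R$, let $D_{r'\times |R|}$ be the (directed) graph obtained from $D$ by replacing $r'$ with a stable set $S$ of size $|R|$, each of whose vertices is joined to the rest of $D$ exactly as $r'$ was (same arcs with the same orientations). The right-left-degeneracy $\mathrm{deg}_{\mathrm{RL}}(D,R,r')$ is the minimum $k$ such that (the underlying graph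 of) $D_{r'\times |R|}$ has an $S$-last $k$-elimination ordering. -}

module Defs where

open import Data.Nat using (ℕ; zero; suc; _+_; _*_; _≤_; pred)
open import Data.Bool using (Bool; true; false; T; _∨_; _∧_; not)
open import Data.Fin using (Fin; splitAt; punchIn; _<_; _<?_)
open import Data.Fin.Subset using (Subset; _∈_; _∉_; _⊆_; _⊂_; ∣_∣)
open import Data.Fin.Permutation using (Permutation′; _⟨$⟩ʳ_)
open import Data.Vec using (tabulate)
open import Data.List using (List; []; _∷_; _++_; [_]; length)
open import Data.List.Relation.Unary.All using (All)
open import Data.List.Relation.Unary.Unique.Propositional using (Unique)
open import Data.Sum using (_⊎_; inj₁; inj₂)
open import Data.Product using (Σ; _×_; ∃)
open import Data.Unit using (⊤)
open import Data.Empty using (⊥)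
open import Relation.Nullary using (¬_)
open import Relation.Binary.PropositionalEquality using (_≡_)
open import Relation.Nullary.Decidable using (isYes)

data Kind : Set where
  undirected directed : Kind

-- Adjacency on vertex set Fin n.  For undirected graphs A u v = A v u;
-- for directed (oriented) graphs A u v = true means there is an arc u → v.
Adj : ℕ → Set
Adj n = Fin n → Fin n → Bool

IsGraph : Kind → {n : ℕ} → Adj n → Set
IsGraph undirected A = (∀ v → ¬ T (A v v)) × (∀ u v → A u v ≡ A v u)
IsGraph directed   A = (∀ v → ¬ T (A v v)) × (∀ u v → T (A u v) → ¬ T (A v u))

Chain : {n : ℕ} → Adj n → List (Fin n) → Set
Chain A []           = ⊤
Chain A (x ∷ [])     = ⊤
Chain A (x ∷ y ∷ xs) = T (A x y) × Chain A (y ∷ xs)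

minCycleLength : Kind → ℕ
minCycleLength undirected = 3
minCycleLength directed   = 2

Cycle : (κ : Kind) {n : ℕ} → Adj n → List (Fin n) → Set
Cycle κ A []       = ⊥
Cycle κ A (x ∷ xs) =
  Unique (x ∷ xs) × (minCycleLength κ ≤ length (x ∷ xs)) × Chain A ((x ∷ xs) ++ [ x ])

IsFVS : (κ : Kind) {n : ℕ} → Adj n → Subset n → Set
IsFVS κ A X = ∀ c → Cycle κ A c → All (_∉ X) c → ⊥

IsMinFVS : (κ : Kind) {n : ℕ} → Adj n → Subset n → Set
IsMinFVS κ A X = IsFVS κ A X × (∀ Y → IsFVS κ A Y → ∣ X ∣ ≤ ∣ Y ∣)

FVSNumber : (κ : Kind) {n : ℕ} → Adj n → ℕ → Set
FVSNumber κ A k = Σ (Subset _) λ X → IsMinFVS κ A X × ∣ X ∣ ≡ k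

IsBad : (κ : Kind) {n : ℕ} → Adj n → Subset n → Set
IsBad κ A R = ¬ (Σ (Subset _) λ X → IsMinFVS κ A X × R ⊆ X)

IsMinimalBad : (κ : Kind) {n : ℕ} → Adj n → Subset n → Set
IsMinimalBad κ A R = IsBad κ A R × (∀ R′ → R′ ⊂ R → ¬ IsBad κ A R′)

und : {n : ℕ} → Adj n → Adj n
und A u v = A u v ∨ A v u

earlierNbrs : {n : ℕ} → Adj n → Permutation′ n → Fin n → Subset n
earlierNbrs A φ v = tabulate λ u → und A u v ∧ isYes ((φ ⟨$⟩ʳ u) <? (φ ⟨$⟩ʳ v))

-- φ is a k-elimination ordering (φ a bijection V → [|V|], here Fin n ≃ Fin n).
IsElimOrdering : {n : ℕ} → Adj n → ℕ → Permutation′ n → Set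
IsElimOrdering A k φ = ∀ v → ∣ earlierNbrs A φ v ∣ ≤ k

Degeneracy : {n : ℕ} → Adj n → ℕ → Set
Degeneracy A k =
  Σ (Permutation′ _) (IsElimOrdering A k) ×
  (∀ j → Σ (Permutation′ _) (IsElimOrdering A j) → k ≤ j)

IsSLast : {n : ℕ} → Subset n → Permutation′ n → Set
IsSLast S φ = ∀ u v → u ∈ S → v ∉ S → (φ ⟨$⟩ʳ u) < (φ ⟨$⟩ʳ v)

-- D_{r' × m}: replace vertex r' by a stable set S of m copies of r'.
-- Vertex set Fin (m + (n-1)): the first m vertices form S, the remaining
-- n-1 are the vertices of D other than r' (via punchIn r').
blowOrig : {n : ℕ} (m : ℕ) → Fin n → Fin (m + pred n) → Fin n
blowOrig {suc n} m r′ x with splitAt m x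
... | inj₁ _ = r′
... | inj₂ w = punchIn r′ w

blowS : {n : ℕ} (m : ℕ) → Fin (m + pred n) → Bool
blowS m x with splitAt m x
... | inj₁ _ = true
... | inj₂ _ = false

blowUp : {n : ℕ} → Adj n → Fin n → (m : ℕ) → Adj (m + pred n)
blowUp {n} A r′ m x y with blowS {n} m x | blowS {n} m y
... | true | true = false
... | _    | _    = A (blowOrig m r′ x) (blowOrig m r′ y)

blowSet : {n : ℕ} (m : ℕ) → Subset (m + pred n)
blowSet {n} m = tabulate (blowS {n} m)

RLDegeneracy : {n : ℕ} → Adj n → Subset n → Fin n → ℕ → Set
RLDegeneracy {n} A R r′ k =
  Σ (Permutation′ _) (λ φ → IsSLast S φ × IsElimOrdering B k φ) ×
  (∀ j → Σ (Permutation′ _) (λ φ → IsSLast S φ × IsElimOrdering B j φ) → k ≤ j)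
  where
  B = blowUp A r′ ∣ R ∣
  S = blowSet {n} ∣ R ∣

{-# OPTIONS --safe #-}

-- D_i is built from a single vertex by gluing, i + 1 times, a copy of D − r′ whose r′ is played by
-- the copy of R in the layer below (so D_0 ≅ D).  Lower bound: if X is a feedback vertex set of the
-- graph with k + 1 layers, the new layer of X plus r′ (when X contains the copy of R below), or plus a
-- vertex of that copy outside X standing in for r′, is a feedback vertex set of D; if X also contains
-- the new copy of R, this set contains R and, R being bad, is not minimum.  So by induction a feedback
-- vertex set of the graph with k layers has at least kf vertices, and one more if it contains the top
-- copy of R.  Upper bound, R minimally bad: pick r₂ ∈ R and a minimum feedback vertex set Y ⊇ R − r₂,
-- so r₂ ∉ Y.  If r′ ∉ Y, delete Y − r′ in every layer: outside it each layer meets the ones below only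
-- in the copy of r₂, and collapsing the lower layers onto r′ maps cycles to cycles of D − Y.  If r′ ∈ Y,
-- delete (Y + r₂) − r′ in every layer but the top one, where Y − r′ suffices: all copies of R below the
-- top are deleted, so no cycle passes between layers.  Degeneracy: order the layers bottom-up, each as
-- φ orders V(D) − r′; a vertex then has at most |R| earlier neighbours in the layer below, just as its
-- copy in D_{r′×|R|} has in S.

module Submission where

open import Defs
open import Data.Bool using (Bool; true; false; T; _∨_; _∧_) renaming (_≟_ to _≟ᵇ_)
open import Data.Bool.Properties using (∧-comm; ∧-zeroʳ; ∧-distribˡ-∨; T-∧; T-≡; ¬-not; ∧-identityʳ)
open import Data.Empty using (⊥; ⊥-elim)
open import Data.Fin as Fin using (Fin; zero; suc; toℕ; fromℕ<; splitAt; _↑ˡ_; _↑ʳ_; punchIn; punchOut)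
open import Data.Fin.Properties
  using (_≟_; any?; toℕ<n; toℕ-fromℕ<; toℕ-injective; splitAt-↑ˡ; splitAt-↑ʳ; join-splitAt; punchIn-punchOut;
         ↑ˡ-injective; ↑ʳ-injective; punchIn-injective; punchInᵢ≢i; punchOut-injective; injective⇒≤)
open import Data.Fin.Permutation using (Permutation′; permutation; _⟨$⟩ʳ_; _⟨$⟩ˡ_; inverseˡ)
open import Data.Fin.Subset using (Subset; _∈_; _∉_; _⊆_; _-_; ∣_∣; Nonempty)
open import Data.Fin.Subset.Properties using (nonempty?; x∈p∧x≢y⇒x∈p-y; x∈p⇒p-x⊂p; x∈p⇒∣p-x∣<∣p∣)
open import Data.List using (List; []; _∷_; _++_; [_]; length; map)
open import Data.List.Membership.Propositional using (find) renaming (_∈_ to _∈ₗ_)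
open import Data.List.Membership.Propositional.Properties using (∈-∃++)
open import Data.List.Properties using (++-assoc; length-map; map-++; length-++; ++-identityʳ)
open import Data.List.Relation.Unary.All as All using (All; []; _∷_)
import Data.List.Relation.Unary.All.Properties as All
open import Data.List.Relation.Unary.All.Properties using (¬Any⇒All¬)
open import Data.List.Relation.Unary.Any as Any using (here; there)
open import Data.List.Relation.Unary.AllPairs using ([]; _∷_)
open import Data.List.Relation.Unary.Unique.Propositional using (Unique)
import Data.List.Relation.Unary.Unique.Propositional.Properties as Unique
open import Data.Nat using (ℕ; zero; suc; _+_; _*_; _∸_; _≤_; _<_; z≤n; s≤s; _<?_; _≤?_)
open import Data.Nat.Properties hiding (_≟_; _<?_)
open import Algebra.Properties.CommutativeSemigroup +-commutativeSemigroup using (x∙yz≈y∙xz)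
open import Data.Product using (Σ; _×_; _,_; proj₁; proj₂; ∃)
open import Data.Sum as Sum using (_⊎_; inj₁; inj₂; [_,_]′)
open import Data.Unit using (tt)
import Data.Vec as Vec
open Vec using (lookup; tabulate)
open import Data.Vec.Properties using (lookup∘tabulate; []=⇒lookup; lookup⇒[]=)
open import Data.Vec.Functional using (Vector; removeAt; insertAt) renaming (_++_ to _⧺_)
open import Data.Vec.Functional.Properties using (insertAt-lookup; insertAt-punchIn; lookup-++ˡ; lookup-++ʳ)
open import Function using (_∘_; const; id)
open import Function.Bundles using (Equivalence)
open import Relation.Binary using (tri<; tri≈; tri>)
open import Relation.Binary.PropositionalEquality hiding ([_])
open import Relation.Nullary using (¬_; Dec; yes; no; contradiction)
open import Relation.Nullary.Decidable using (isYes; isYes≗does; _×-dec_; decidable-stable; toWitness; fromWitness; dec-true; dec-false)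

private variable
  n m N : ℕ

-- Boolean vectors

bit : Bool → ℕ
bit false = 0
bit true  = 1

count : Vector Bool n → ℕ
count {zero}  p = 0
count {suc n} p = bit (p zero) + count (p ∘ suc)

count-cong : {p q : Vector Bool n} → (∀ i → p i ≡ q i) → count p ≡ count q
count-cong {zero}  e = refl
count-cong {suc n} e = cong₂ _+_ (cong bit (e zero)) (count-cong (e ∘ suc))

bit-mono : ∀ {a b} → (T a → T b) → bit a ≤ bit b
bit-mono {false}         _ = z≤n
bit-mono {true} {true}   _ = ≤-refl
bit-mono {true} {false}  h = ⊥-elim (h tt)

count-mono : {p q : Vector Bool n} → (∀ i → T (p i) → T (q i)) → count p ≤ count q
count-mono {zero}  h = z≤n
count-mono {suc n} h = +-mono-≤ (bit-mono (h zero)) (count-mono (h ∘ suc))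

bit≤1 : ∀ b → bit b ≤ 1
bit≤1 false = z≤n
bit≤1 true  = ≤-refl

count≤n : (p : Vector Bool n) → count p ≤ n
count≤n {zero}  p = z≤n
count≤n {suc n} p = +-mono-≤ (bit≤1 (p zero)) (count≤n (p ∘ suc))

count-true : count {n} (const true) ≡ n
count-true {zero}  = refl
count-true {suc n} = cong suc (count-true {n})

count-false : count {n} (const false) ≡ 0
count-false {zero}  = refl
count-false {suc n} = count-false {n}

count-splitAt : ∀ m (p : Vector Bool (m + N)) → count p ≡ count (p ∘ (_↑ˡ N)) + count (p ∘ (m ↑ʳ_))
count-splitAt zero    p = refl
count-splitAt (suc m) p = trans (cong (bit (p zero) +_) (count-splitAt m (p ∘ suc))) (sym (+-assoc (bit (p zero)) _ _))

count-++ : (p : Vector Bool m) (q : Vector Bool N) → count (p ⧺ q) ≡ count p + count q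
count-++ {m} p q = trans (count-splitAt m (p ⧺ q)) (cong₂ _+_ (count-cong (lookup-++ˡ p q)) (count-cong (lookup-++ʳ p q)))

count-removeAt : (p : Vector Bool (suc n)) (i : Fin (suc n)) → count p ≡ bit (p i) + count (removeAt p i)
count-removeAt p zero = refl
count-removeAt {suc n} p (suc i) = begin
  bit (p zero) + count (p ∘ suc)                               ≡⟨ cong (bit (p zero) +_) (count-removeAt (p ∘ suc) i) ⟩
  bit (p zero) + (bit (p (suc i)) + count (removeAt (p ∘ suc) i)) ≡⟨ x∙yz≈y∙xz (bit (p zero)) (bit (p (suc i))) _ ⟩
  bit (p (suc i)) + count (removeAt p (suc i))                 ∎
  where open ≡-Reasoning

count-removeAt-false : (p : Vector Bool (suc n)) (i : Fin (suc n)) → p i ≡ false → count (removeAt p i) ≡ count p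
count-removeAt-false p i pᵢ = sym (trans (count-removeAt p i) (cong (λ b → bit b + count (removeAt p i)) pᵢ))

count-removeAt-true : (p : Vector Bool (suc n)) (i : Fin (suc n)) → p i ≡ true → suc (count (removeAt p i)) ≡ count p
count-removeAt-true p i pᵢ = sym (trans (count-removeAt p i) (cong (λ b → bit b + count (removeAt p i)) pᵢ))

count-insertAt : (p : Vector Bool n) (i : Fin (suc n)) (b : Bool) → count (insertAt p i b) ≡ bit b + count p
count-insertAt p i b = trans (count-removeAt (insertAt p i b) i)
  (cong₂ _+_ (cong bit (insertAt-lookup p i b)) (count-cong (insertAt-punchIn p i b)))

count<n : (p : Vector Bool n) (i : Fin n) → p i ≡ false → count p < n
count<n {suc n} p i pᵢ = s≤s (subst (_≤ n) (count-removeAt-false p i pᵢ) (count≤n (removeAt p i)))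

count-<-mono : {p q : Vector Bool n} → (∀ i → T (p i) → T (q i)) → ∀ j → p j ≡ false → q j ≡ true → count p < count q
count-<-mono {suc n} {p} {q} p⊆q j pⱼ qⱼ = begin-strict
  count p                     ≡⟨ count-removeAt-false p j pⱼ ⟨
  count (removeAt p j)        <⟨ s≤s (count-mono (p⊆q ∘ punchIn j)) ⟩
  suc (count (removeAt q j))  ≡⟨ count-removeAt-true q j qⱼ ⟩
  count q                     ∎
  where open ≤-Reasoning

count-∧ʳ : ∀ {k} (p : Vector Bool n) c → count p ≤ k → count (λ i → p i ∧ c) ≤ count {k} (const c)
count-∧ʳ {k = k} p true  p≤k = subst₂ _≤_ (count-cong (sym ∘ ∧-identityʳ ∘ p)) (sym (count-true {k})) p≤k
count-∧ʳ {n} {k} p false _   = ≤-reflexive (trans (count-cong (∧-zeroʳ ∘ p)) (trans (count-false {n}) (sym (count-false {k}))))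

0<count⇒∃true : (p : Vector Bool n) → 0 < count p → ∃ λ i → p i ≡ true
0<count⇒∃true {suc n} p 0<count with p zero in p₀
... | true  = zero , p₀
... | false = let (i , pᵢ) = 0<count⇒∃true (p ∘ suc) 0<count in suc i , pᵢ

∣p∣≡count : (X : Subset n) → ∣ X ∣ ≡ count (lookup X)
∣p∣≡count Vec.[] = refl
∣p∣≡count (true  Vec.∷ X) = cong suc (∣p∣≡count X)
∣p∣≡count (false Vec.∷ X) = ∣p∣≡count X

∣tabulate∣≡count : (p : Vector Bool n) → ∣ tabulate p ∣ ≡ count p
∣tabulate∣≡count p = trans (∣p∣≡count (tabulate p)) (count-cong (lookup∘tabulate p))

_⊆ᵇ_ : Vector Bool n → Vector Bool n → Set
p ⊆ᵇ q = ∀ i → p i ≡ true → q i ≡ true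

⊆ᵇ⇒∌ : {p q : Vector Bool n} → p ⊆ᵇ q → ∀ i → q i ≡ false → p i ≡ false
⊆ᵇ⇒∌ {p = p} p⊆q i qᵢ with p i in pᵢ
... | false = refl
... | true  = trans (sym (p⊆q i pᵢ)) qᵢ

-- Feedback vertex sets

∉⇒lookup≡false : {X : Subset n} {x : Fin n} → x ∉ X → lookup X x ≡ false
∉⇒lookup≡false {X = X} {x} x∉X with lookup X x in eq
... | false = refl
... | true  = ⊥-elim (x∉X (lookup⇒[]= x X eq))

lookup≡false⇒∉ : {X : Subset n} {x : Fin n} → lookup X x ≡ false → x ∉ X
lookup≡false⇒∉ eq x∈X with () ← trans (sym eq) ([]=⇒lookup x∈X)

IsFVSᵇ : Kind → Adj n → Vector Bool n → Set
IsFVSᵇ κ A X = ∀ c → Cycle κ A c → All (λ v → X v ≡ false) c → ⊥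

IsFVS⇒IsFVSᵇ : ∀ {κ} {A : Adj n} {X} → IsFVS κ A X → IsFVSᵇ κ A (lookup X)
IsFVS⇒IsFVSᵇ fvs c cyc avoids = fvs c cyc (All.map lookup≡false⇒∉ avoids)

IsFVSᵇ⇒IsFVS : ∀ {κ} {A : Adj n} {p} → IsFVSᵇ κ A p → IsFVS κ A (tabulate p)
IsFVSᵇ⇒IsFVS {p = p} fvs c cyc avoids =
  fvs c cyc (All.map (λ {v} v∉ → trans (sym (lookup∘tabulate p v)) (∉⇒lookup≡false v∉)) avoids)

IsFVSᵇ-cong : ∀ {κ} {A : Adj n} {p q} → (∀ v → p v ≡ q v) → IsFVSᵇ κ A p → IsFVSᵇ κ A q
IsFVSᵇ-cong p≗q fvs c cyc avoids = fvs c cyc (All.map (λ {v} qv → trans (p≗q v) qv) avoids)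

FVSNumber⇒≤count : ∀ {κ} {A : Adj n} {f p} → FVSNumber κ A f → IsFVSᵇ κ A p → f ≤ count p
FVSNumber⇒≤count {p = p} (X , (_ , minimum) , ∣X∣≡f) fvs =
  subst₂ _≤_ ∣X∣≡f (∣tabulate∣≡count p) (minimum (tabulate p) (IsFVSᵇ⇒IsFVS fvs))

≤FVSNumber : ∀ {κ} {A : Adj n} {b g} → (∀ X → IsFVSᵇ κ A X → b ≤ count X) → FVSNumber κ A g → b ≤ g
≤FVSNumber bounded (X , (fvs , _) , ∣X∣≡g) =
  subst (_ ≤_) (trans (sym (∣p∣≡count X)) ∣X∣≡g) (bounded (lookup X) (IsFVS⇒IsFVSᵇ fvs))

IsMinFVS⇒∣∣≡ : ∀ {κ} {A : Adj n} {f Y} → FVSNumber κ A f → IsMinFVS κ A Y → ∣ Y ∣ ≡ f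
IsMinFVS⇒∣∣≡ (X , (fvsX , minX) , ∣X∣≡f) (fvsY , minY) = trans (≤-antisym (minY X fvsX) (minX _ fvsY)) ∣X∣≡f

IsBad⇒Nonempty : ∀ {κ} {A : Adj n} {f R} → IsBad κ A R → FVSNumber κ A f → Nonempty R
IsBad⇒Nonempty {R = R} bad (X , minX , _) with nonempty? R
... | yes nonempty = nonempty
... | no  empty    = contradiction (X , minX , λ {v} v∈R → contradiction (v , v∈R) empty) bad

IsBad⇒<count : ∀ {κ} {A : Adj n} {f R p} → IsBad κ A R → FVSNumber κ A f → IsFVSᵇ κ A p →
               (∀ v → v ∈ R → p v ≡ true) → f < count p
IsBad⇒<count {κ = κ} {A} {f} {R} {p} bad (X , (_ , minimum) , ∣X∣≡f) fvs R⊆p with f <? count p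
... | yes f<count = f<count
... | no  f≮count = ⊥-elim (bad (tabulate p , (IsFVSᵇ⇒IsFVS fvs , isMinimum) , R⊆tabulate))
  where
  isMinimum : ∀ Y → IsFVS κ A Y → ∣ tabulate p ∣ ≤ ∣ Y ∣
  isMinimum Y fvsY = begin
    ∣ tabulate p ∣ ≡⟨ ∣tabulate∣≡count p ⟩
    count p        ≤⟨ ≮⇒≥ f≮count ⟩
    f              ≡⟨ ∣X∣≡f ⟨
    ∣ X ∣          ≤⟨ minimum Y fvsY ⟩
    ∣ Y ∣          ∎
    where open ≤-Reasoning
  R⊆tabulate : R ⊆ tabulate p
  R⊆tabulate {v} v∈R = lookup⇒[]= v (tabulate p) (trans (lookup∘tabulate p v) (R⊆p v v∈R))

IsFVSᵇ-edgeless : ∀ {κ} {X : Vector Bool n} → IsFVSᵇ κ (λ _ _ → false) X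
IsFVSᵇ-edgeless (_ ∷ [])    (_ , _ , () , _) _
IsFVSᵇ-edgeless (_ ∷ _ ∷ _) (_ , _ , () , _) _

-- Cycles

module _ {a b} {A : Adj a} {B : Adj b} (f : Fin a → Fin b) (P : Fin a → Set)
         (f-injective : ∀ u v → P u → P v → f u ≡ f v → u ≡ v)
         (f-homomorphic : ∀ u v → P u → P v → T (A u v) → T (B (f u) (f v))) where

  private
    map-≢ : ∀ {x} l → P x → All P l → All (x ≢_) l → All (f x ≢_) (map f l)
    map-≢ []      _  []         []           = []
    map-≢ (y ∷ l) px (py ∷ pl) (x≢y ∷ x≢l) = (x≢y ∘ f-injective _ y px py) ∷ map-≢ l px pl x≢l

    map-Unique : ∀ l → All P l → Unique l → Unique (map f l)
    map-Unique []      _          _          = []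
    map-Unique (x ∷ l) (px ∷ pl) (x∉ ∷ uniq) = map-≢ l px pl x∉ ∷ map-Unique l pl uniq

    map-Chain : ∀ l → All P l → Chain A l → Chain B (map f l)
    map-Chain []          _               _          = tt
    map-Chain (x ∷ [])    _               _          = tt
    map-Chain (x ∷ y ∷ l) (px ∷ py ∷ pl) (e , chain) =
      f-homomorphic x y px py e , map-Chain (y ∷ l) (py ∷ pl) chain

  Cycle-map : ∀ κ c → All P c → Cycle κ A c → Cycle κ B (map f c)
  Cycle-map κ c@(x ∷ xs) pc (uniq , long , chain) =
    map-Unique c pc uniq ,
    subst (minCycleLength κ ≤_) (sym (length-map f c)) long ,
    subst (Chain B) (map-++ f c [ x ]) (map-Chain (c ++ [ x ]) (All.++⁺ pc (All.head pc ∷ [])) chain)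

  IsFVSᵇ-pullback : ∀ {κ Y X} → IsFVSᵇ κ B X → (∀ u → Y u ≡ false → P u) →
                    (∀ u → P u → X (f u) ≡ false) → IsFVSᵇ κ A Y
  IsFVSᵇ-pullback {κ} fvs Y∌⇒P P⇒X∌ c cyc avoids =
    fvs (map f c) (Cycle-map κ c pc cyc) (All.map⁺ (All.map (λ {u} → P⇒X∌ u) pc))
    where pc = All.map (λ {u} → Y∌⇒P u) avoids

module _ {A : Adj n} where

  Chain-split : ∀ a l₁ b l₂ → Chain A (a ∷ l₁ ++ b ∷ l₂) → Chain A (a ∷ l₁ ++ [ b ]) × Chain A (b ∷ l₂)
  Chain-split a []       b l₂ (e , chain) = (e , tt) , chain
  Chain-split a (x ∷ l₁) b l₂ (e , chain) with Chain-split x l₁ b l₂ chain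
  ... | chain₁ , chain₂ = (e , chain₁) , chain₂

  Chain-join : ∀ a l₁ b l₂ → Chain A (a ∷ l₁ ++ [ b ]) → Chain A (b ∷ l₂) → Chain A (a ∷ l₁ ++ b ∷ l₂)
  Chain-join a []       b l₂ (e , _)      chain₂ = e , chain₂
  Chain-join a (x ∷ l₁) b l₂ (e , chain₁) chain₂ = e , Chain-join x l₁ b l₂ chain₁ chain₂

Unique-++⁻ : ∀ {A : Set} (xs ys : List A) → Unique (xs ++ ys) →
             Unique xs × Unique ys × (∀ {v} → v ∈ₗ xs → v ∈ₗ ys → ⊥)
Unique-++⁻ []       ys uniq = [] , uniq , λ ()
Unique-++⁻ (x ∷ xs) ys (x∉ ∷ uniq) with Unique-++⁻ xs ys uniq
... | uniq-xs , uniq-ys , disjoint = All.++⁻ˡ xs x∉ ∷ uniq-xs , uniq-ys , disjoint′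
  where
  disjoint′ : ∀ {v} → v ∈ₗ x ∷ xs → v ∈ₗ ys → ⊥
  disjoint′ (here refl) v∈ys = All.lookup (All.++⁻ʳ xs x∉) v∈ys refl
  disjoint′ (there v∈xs) v∈ys = disjoint v∈xs v∈ys

Unique-rotate : ∀ {A : Set} (xs ys : List A) → Unique (xs ++ ys) → Unique (ys ++ xs)
Unique-rotate xs ys uniq with Unique-++⁻ xs ys uniq
... | uniq-xs , uniq-ys , disjoint = Unique.++⁺ uniq-ys uniq-xs (λ (v∈ys , v∈xs) → disjoint v∈xs v∈ys)

All-rotate : ∀ {A : Set} {P : A → Set} (xs ys : List A) → All P (xs ++ ys) → All P (ys ++ xs)
All-rotate xs ys all = All.++⁺ (All.++⁻ʳ xs all) (All.++⁻ˡ xs all)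

Cycle-rotate : ∀ {κ} {A : Adj n} xs y ys → Cycle κ A (xs ++ y ∷ ys) → Cycle κ A (y ∷ ys ++ xs)
Cycle-rotate {κ = κ} {A} [] y ys cyc = subst (Cycle κ A) (cong (y ∷_) (sym (++-identityʳ ys))) cyc
Cycle-rotate {κ = κ} {A} (x ∷ xs) y ys (uniq , long , chain) =
  Unique-rotate (x ∷ xs) (y ∷ ys) uniq ,
  subst (minCycleLength κ ≤_) length-rotate long ,
  subst (Chain A) (cong (y ∷_) (sym (++-assoc ys (x ∷ xs) [ y ]))) (Chain-join y ys x (xs ++ [ y ]) chain₂ chain₁)
  where
  length-rotate : length (x ∷ xs ++ y ∷ ys) ≡ length (y ∷ ys ++ x ∷ xs)
  length-rotate = trans (length-++ (x ∷ xs)) (trans (+-comm (length (x ∷ xs)) _) (sym (length-++ (y ∷ ys))))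
  split = Chain-split x xs y (ys ++ [ x ]) (subst (Chain A) (cong (x ∷_) (++-assoc xs (y ∷ ys) [ x ])) chain)
  chain₁ = proj₁ split
  chain₂ = proj₂ split

T-∧⁻ : ∀ a {b} → T (a ∧ b) → T a × T b
T-∧⁻ a = Equivalence.to (T-∧ {a})

IsGraph⇒irreflexive : ∀ {κ} {A : Adj n} → IsGraph κ A → ∀ v → ¬ T (A v v)
IsGraph⇒irreflexive {κ = undirected} = proj₁
IsGraph⇒irreflexive {κ = directed}   = proj₁

data SplitView (m N : ℕ) : Fin (m + N) → Set where
  inˡ : (w : Fin m) → SplitView m N (w ↑ˡ N)
  inʳ : (z : Fin N) → SplitView m N (m ↑ʳ z)

splitView : ∀ m {N} (x : Fin (m + N)) → SplitView m N x
splitView m {N} x = subst (SplitView m N) (join-splitAt m N x) (view (splitAt m x))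
  where
  view : (s : Fin m ⊎ Fin N) → SplitView m N (Fin.join m N s)
  view (inj₁ w) = inˡ w
  view (inj₂ z) = inʳ z

data PunchInView (i : Fin (suc n)) : Fin (suc n) → Set where
  at      : PunchInView i i
  punched : (j : Fin n) → PunchInView i (punchIn i j)

punchInView : (i v : Fin (suc n)) → PunchInView i v
punchInView i v with i ≟ v
... | yes refl = at
... | no  i≢v  = subst (PunchInView i) (punchIn-punchOut i≢v) (punched (punchOut i≢v))

↑ˡ≢↑ʳ : (w : Fin m) (z : Fin N) → w ↑ˡ N ≢ m ↑ʳ z
↑ˡ≢↑ʳ {m} {N} w z eq with () ← trans (sym (splitAt-↑ˡ m w N)) (trans (cong (splitAt m) eq) (splitAt-↑ʳ m N z))

-- Elimination orderings from injective labellings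

-- Fin's _<?_ compares toℕ, so earlierNbrs G φ v is tabulate (earlierᵇ G (toℕ ∘ (φ ⟨$⟩ʳ_)) v) by definition.
earlierᵇ : Adj n → (Fin n → ℕ) → Fin n → Vector Bool n
earlierᵇ G h v u = und G u v ∧ isYes (h u <? h v)

IsElimOrdering⇒count≤ : ∀ {G : Adj n} {d φ} → IsElimOrdering G d φ →
                        ∀ v → count (earlierᵇ G (toℕ ∘ (φ ⟨$⟩ʳ_)) v) ≤ d
IsElimOrdering⇒count≤ {G = G} {φ = φ} elim v =
  subst (_≤ _) (∣tabulate∣≡count (earlierᵇ G (toℕ ∘ (φ ⟨$⟩ʳ_)) v)) (elim v)

isYes-true : ∀ {A : Set} (a? : Dec A) → A → isYes a? ≡ true
isYes-true a? a = trans (isYes≗does a?) (dec-true a? a)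

isYes-false : ∀ {A : Set} (a? : Dec A) → ¬ A → isYes a? ≡ false
isYes-false a? ¬a = trans (isYes≗does a?) (dec-false a? ¬a)

isYes-⇔ : ∀ {A B : Set} (a? : Dec A) (b? : Dec B) → (A → B) → (B → A) → isYes a? ≡ isYes b?
isYes-⇔ (yes _) (yes _) _   _   = refl
isYes-⇔ (yes a) (no ¬b) a⇒b _   = contradiction (a⇒b a) ¬b
isYes-⇔ (no ¬a) (yes b) _   b⇒a = contradiction (b⇒a b) ¬a
isYes-⇔ (no _)  (no _)  _   _   = refl

injective⇒surjective : (f : Fin n → Fin n) → (∀ u v → f u ≡ f v → u ≡ v) → ∀ y → ∃ λ x → f x ≡ y
injective⇒surjective {suc n} f f-injective y with any? (λ x → f x ≟ y)
... | yes hit  = hit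
... | no  miss = contradiction (injective⇒≤ g-injective) (<-irrefl refl)
  where
  g : Fin (suc n) → Fin n
  g x = punchOut {i = y} {j = f x} (λ y≡fx → miss (x , sym y≡fx))
  g-injective : ∀ {u v} → g u ≡ g v → u ≡ v
  g-injective {u} {v} eq = f-injective u v (punchOut-injective {i = y} _ _ eq)

module Ranking {n} (h : Fin n → ℕ) (h-injective : ∀ u v → h u ≡ h v → u ≡ v) where

  rank : Fin n → ℕ
  rank v = count (λ u → isYes (h u <? h v))

  rank<n : ∀ v → rank v < n
  rank<n v = count<n _ v (isYes-false (h v <? h v) (<-irrefl refl))

  rank-mono : ∀ u v → h u < h v → rank u < rank v
  rank-mono u v hu<hv = count-<-mono below-u⇒below-v u (isYes-false (h u <? h u) (<-irrefl refl)) (isYes-true (h u <? h v) hu<hv)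
    where
    below-u⇒below-v : ∀ x → T (isYes (h x <? h u)) → T (isYes (h x <? h v))
    below-u⇒below-v x below = fromWitness (<-trans (toWitness below) hu<hv)

  rank-<⇒ : ∀ u v → rank u < rank v → h u < h v
  rank-<⇒ u v ru<rv with <-cmp (h u) (h v)
  ... | tri< hu<hv _ _ = hu<hv
  ... | tri≈ _ hu≡hv _ rewrite h-injective u v hu≡hv = contradiction ru<rv (<-irrefl refl)
  ... | tri> _ _ hu>hv = contradiction ru<rv (<-asym (rank-mono v u hu>hv))

  rank-injective : ∀ u v → rank u ≡ rank v → u ≡ v
  rank-injective u v ru≡rv with <-cmp (h u) (h v)
  ... | tri< hu<hv _ _ = contradiction (rank-mono u v hu<hv) (<-irrefl ru≡rv)
  ... | tri≈ _ hu≡hv _ = h-injective u v hu≡hv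
  ... | tri> _ _ hu>hv = contradiction (rank-mono v u hu>hv) (<-irrefl (sym ru≡rv))

  position : Fin n → Fin n
  position v = fromℕ< (rank<n v)

  toℕ-position : ∀ v → toℕ (position v) ≡ rank v
  toℕ-position v = toℕ-fromℕ< (rank<n v)

  position-injective : ∀ u v → position u ≡ position v → u ≡ v
  position-injective u v eq = rank-injective u v (trans (sym (toℕ-position u)) (trans (cong toℕ eq) (toℕ-position v)))

  ordering : Permutation′ n
  ordering = permutation position (proj₁ ∘ surjective) (proj₂ ∘ surjective)
                         (λ x → position-injective _ x (proj₂ (surjective (position x))))
    where surjective = injective⇒surjective position position-injective

  earlierᵇ-ordering : ∀ (G : Adj n) v u → earlierᵇ G (toℕ ∘ (ordering ⟨$⟩ʳ_)) v u ≡ earlierᵇ G h v u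
  earlierᵇ-ordering G v u = cong (und G u v ∧_) (isYes-⇔ _ _
    (λ pu<pv → rank-<⇒ u v (subst₂ _<_ (toℕ-position u) (toℕ-position v) pu<pv))
    (λ hu<hv → subst₂ _<_ (sym (toℕ-position u)) (sym (toℕ-position v)) (rank-mono u v hu<hv)))

labelling⇒ElimOrdering : ∀ {G : Adj n} {d} (h : Fin n → ℕ) → (∀ u v → h u ≡ h v → u ≡ v) →
                         (∀ v → count (earlierᵇ G h v) ≤ d) → Σ (Permutation′ n) (IsElimOrdering G d)
labelling⇒ElimOrdering {G = G} {d} h h-injective bounded = ordering , λ v →
  subst (_≤ d) (sym (trans (∣tabulate∣≡count (earlierᵇ G (toℕ ∘ (ordering ⟨$⟩ʳ_)) v)) (count-cong (earlierᵇ-ordering G v))))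
        (bounded v)
  where open Ranking h h-injective

-- Gluing copies of D − r′

module Glue {m : ℕ} (A : Adj (suc m)) (r′ : Fin (suc m)) where

  private
    glue⊎ : Adj N → Vector Bool N → Fin m ⊎ Fin N → Fin m ⊎ Fin N → Bool
    glue⊎ B Q (inj₁ w) (inj₁ w′) = A (punchIn r′ w) (punchIn r′ w′)
    glue⊎ B Q (inj₁ w) (inj₂ z)  = A (punchIn r′ w) r′ ∧ Q z
    glue⊎ B Q (inj₂ z) (inj₁ w)  = Q z ∧ A r′ (punchIn r′ w)
    glue⊎ B Q (inj₂ z) (inj₂ z′) = B z z′

  glue : Adj N → Vector Bool N → Adj (m + N)
  glue B Q x y = glue⊎ B Q (splitAt m x) (splitAt m y)

  module Glued {N} (B : Adj N) (Q : Vector Bool N) where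

    glue-↑ˡ↑ˡ : ∀ w w′ → glue B Q (w ↑ˡ N) (w′ ↑ˡ N) ≡ A (punchIn r′ w) (punchIn r′ w′)
    glue-↑ˡ↑ˡ w w′ rewrite splitAt-↑ˡ m w N | splitAt-↑ˡ m w′ N = refl

    glue-↑ˡ↑ʳ : ∀ w z → glue B Q (w ↑ˡ N) (m ↑ʳ z) ≡ (A (punchIn r′ w) r′ ∧ Q z)
    glue-↑ˡ↑ʳ w z rewrite splitAt-↑ˡ m w N | splitAt-↑ʳ m N z = refl

    glue-↑ʳ↑ˡ : ∀ z w → glue B Q (m ↑ʳ z) (w ↑ˡ N) ≡ (Q z ∧ A r′ (punchIn r′ w))
    glue-↑ʳ↑ˡ z w rewrite splitAt-↑ˡ m w N | splitAt-↑ʳ m N z = refl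

    glue-↑ʳ↑ʳ : ∀ z z′ → glue B Q (m ↑ʳ z) (m ↑ʳ z′) ≡ B z z′
    glue-↑ʳ↑ʳ z z′ rewrite splitAt-↑ʳ m N z | splitAt-↑ʳ m N z′ = refl

    glue-irreflexive : (∀ v → ¬ T (A v v)) → (∀ z → ¬ T (B z z)) → ∀ x → ¬ T (glue B Q x x)
    glue-irreflexive irreflexiveA irreflexiveB x with splitView m x
    ... | inˡ w rewrite glue-↑ˡ↑ˡ w w = irreflexiveA _
    ... | inʳ z rewrite glue-↑ʳ↑ʳ z z = irreflexiveB z

    glue-isGraph : ∀ κ → IsGraph κ A → IsGraph κ B → IsGraph κ (glue B Q)
    glue-isGraph undirected (irreflexiveA , symmetricA) (irreflexiveB , symmetricB) =
      glue-irreflexive irreflexiveA irreflexiveB , symmetric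
      where
      symmetric : ∀ x y → glue B Q x y ≡ glue B Q y x
      symmetric x y with splitView m x | splitView m y
      ... | inˡ w | inˡ w′ rewrite glue-↑ˡ↑ˡ w w′ | glue-↑ˡ↑ˡ w′ w = symmetricA _ _
      ... | inˡ w | inʳ z  rewrite glue-↑ˡ↑ʳ w z | glue-↑ʳ↑ˡ z w | symmetricA (punchIn r′ w) r′ =
        ∧-comm (A r′ (punchIn r′ w)) (Q z)
      ... | inʳ z | inˡ w  rewrite glue-↑ˡ↑ʳ w z | glue-↑ʳ↑ˡ z w | symmetricA (punchIn r′ w) r′ =
        ∧-comm (Q z) (A r′ (punchIn r′ w))
      ... | inʳ z | inʳ z′ rewrite glue-↑ʳ↑ʳ z z′ | glue-↑ʳ↑ʳ z′ z = symmetricB z z′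
    glue-isGraph directed (irreflexiveA , antisymmetricA) (irreflexiveB , antisymmetricB) =
      glue-irreflexive irreflexiveA irreflexiveB , antisymmetric
      where
      antisymmetric : ∀ x y → T (glue B Q x y) → ¬ T (glue B Q y x)
      antisymmetric x y with splitView m x | splitView m y
      ... | inˡ w | inˡ w′ rewrite glue-↑ˡ↑ˡ w w′ | glue-↑ˡ↑ˡ w′ w = antisymmetricA _ _
      ... | inˡ w | inʳ z  rewrite glue-↑ˡ↑ʳ w z | glue-↑ʳ↑ˡ z w = λ wz zw →
        antisymmetricA _ _ (proj₁ (T-∧⁻ (A (punchIn r′ w) r′) wz)) (proj₂ (T-∧⁻ (Q z) zw))
      ... | inʳ z | inˡ w  rewrite glue-↑ˡ↑ʳ w z | glue-↑ʳ↑ˡ z w = λ zw wz →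
        antisymmetricA _ _ (proj₂ (T-∧⁻ (Q z) zw)) (proj₁ (T-∧⁻ (A (punchIn r′ w) r′) wz))
      ... | inʳ z | inʳ z′ rewrite glue-↑ʳ↑ʳ z z′ | glue-↑ʳ↑ʳ z′ z = antisymmetricB z z′

    IsFVSᵇ-restrictʳ : ∀ {κ X} → IsFVSᵇ κ (glue B Q) X → IsFVSᵇ κ B (X ∘ (m ↑ʳ_))
    IsFVSᵇ-restrictʳ {X = X} fvs = IsFVSᵇ-pullback (m ↑ʳ_) (λ z → X (m ↑ʳ z) ≡ false)
      (λ u v _ _ → ↑ʳ-injective m u v) (λ u v _ _ → subst T (sym (glue-↑ʳ↑ʳ u v))) fvs (λ _ → id) (λ _ → id)

    -- D embeds into the glued graph with z standing in for r′; b records whether r′ is deleted.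
    IsFVSᵇ-restrictˡ : ∀ {κ X} → (∀ v → ¬ T (A v v)) → IsFVSᵇ κ (glue B Q) X → ∀ z b →
                       (b ≡ false → Q z ≡ true × X (m ↑ʳ z) ≡ false) →
                       IsFVSᵇ κ A (insertAt (X ∘ (_↑ˡ N)) r′ b)
    IsFVSᵇ-restrictˡ {X = X} irreflexiveA fvs z b avoidable =
      IsFVSᵇ-pullback embed P embed-injective embed-homomorphic fvs (λ _ → id) P⇒X∌
      where
      Y = insertAt (X ∘ (_↑ˡ N)) r′ b
      P = λ v → Y v ≡ false
      embed : Fin (suc m) → Fin (m + N)
      embed = insertAt (_↑ˡ N) r′ (m ↑ʳ z)
      embed-r′ : embed r′ ≡ m ↑ʳ z
      embed-r′ = insertAt-lookup (_↑ˡ N) r′ (m ↑ʳ z)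
      embed-punchIn : ∀ w → embed (punchIn r′ w) ≡ w ↑ˡ N
      embed-punchIn = insertAt-punchIn (_↑ˡ N) r′ (m ↑ʳ z)
      b≡false : P r′ → b ≡ false
      b≡false = trans (sym (insertAt-lookup (X ∘ (_↑ˡ N)) r′ b))
      embed-injective : ∀ u v → P u → P v → embed u ≡ embed v → u ≡ v
      embed-injective u v _ _ eq with punchInView r′ u | punchInView r′ v
      ... | at        | at         = refl
      ... | at        | punched w  = ⊥-elim (↑ˡ≢↑ʳ w z (trans (sym (embed-punchIn w)) (trans (sym eq) embed-r′)))
      ... | punched w | at         = ⊥-elim (↑ˡ≢↑ʳ w z (trans (sym (embed-punchIn w)) (trans eq embed-r′)))
      ... | punched w | punched w′ =
        cong (punchIn r′) (↑ˡ-injective N w w′ (trans (sym (embed-punchIn w)) (trans eq (embed-punchIn w′))))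
      embed-homomorphic : ∀ u v → P u → P v → T (A u v) → T (glue B Q (embed u) (embed v))
      embed-homomorphic u v Pu Pv e with punchInView r′ u | punchInView r′ v
      ... | at        | at         = ⊥-elim (irreflexiveA r′ e)
      ... | at        | punched w  rewrite embed-r′ | embed-punchIn w | glue-↑ʳ↑ˡ z w
                                         | proj₁ (avoidable (b≡false Pu)) = e
      ... | punched w | at         rewrite embed-r′ | embed-punchIn w | glue-↑ˡ↑ʳ w z
                                         | proj₁ (avoidable (b≡false Pv)) | ∧-identityʳ (A (punchIn r′ w) r′) = e
      ... | punched w | punched w′ rewrite embed-punchIn w | embed-punchIn w′ | glue-↑ˡ↑ˡ w w′ = e
      P⇒X∌ : ∀ v → P v → X (embed v) ≡ false
      P⇒X∌ v Pv with punchInView r′ v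
      ... | at        rewrite embed-r′ = proj₂ (avoidable (b≡false Pv))
      ... | punched w rewrite embed-punchIn w = trans (sym (insertAt-punchIn (X ∘ (_↑ˡ N)) r′ b w)) Pv

    isNew : Fin (m + N) → Bool
    isNew x = [ const true , const false ]′ (splitAt m x)

    collapse : Fin (m + N) → Fin (suc m)
    collapse x = [ punchIn r′ , const r′ ]′ (splitAt m x)

    isNew-↑ˡ : ∀ w → isNew (w ↑ˡ N) ≡ true
    isNew-↑ˡ w rewrite splitAt-↑ˡ m w N = refl

    isNew-↑ʳ : ∀ z → isNew (m ↑ʳ z) ≡ false
    isNew-↑ʳ z rewrite splitAt-↑ʳ m N z = refl

    collapse-↑ˡ : ∀ w → collapse (w ↑ˡ N) ≡ punchIn r′ w
    collapse-↑ˡ w rewrite splitAt-↑ˡ m w N = refl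

    collapse-↑ʳ : ∀ z → collapse (m ↑ʳ z) ≡ r′
    collapse-↑ʳ z rewrite splitAt-↑ʳ m N z = refl

    collapse-injective : ∀ x y → isNew x ≡ true → collapse x ≡ collapse y → x ≡ y
    collapse-injective x y new eq with splitView m x | splitView m y
    ... | inˡ w | inˡ w′ =
      cong (_↑ˡ N) (punchIn-injective r′ w w′ (trans (sym (collapse-↑ˡ w)) (trans eq (collapse-↑ˡ w′))))
    ... | inˡ w | inʳ z  = ⊥-elim (punchInᵢ≢i r′ w (trans (sym (collapse-↑ˡ w)) (trans eq (collapse-↑ʳ z))))
    ... | inʳ z | _      with () ← trans (sym new) (isNew-↑ʳ z)

    collapse-homomorphic : ∀ x y → isNew x ≡ true ⊎ isNew y ≡ true → T (glue B Q x y) → T (A (collapse x) (collapse y))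
    collapse-homomorphic x y new e with splitView m x | splitView m y
    ... | inˡ w | inˡ w′ rewrite collapse-↑ˡ w | collapse-↑ˡ w′ | glue-↑ˡ↑ˡ w w′ = e
    ... | inˡ w | inʳ z  rewrite collapse-↑ˡ w | collapse-↑ʳ z | glue-↑ˡ↑ʳ w z =
      proj₁ (T-∧⁻ (A (punchIn r′ w) r′) e)
    ... | inʳ z | inˡ w  rewrite collapse-↑ˡ w | collapse-↑ʳ z | glue-↑ʳ↑ˡ z w =
      proj₂ (T-∧⁻ (Q z) e)
    ... | inʳ z | inʳ z′ with new
    ...   | inj₁ new-x with () ← trans (sym new-x) (isNew-↑ʳ z)
    ...   | inj₂ new-y with () ← trans (sym new-y) (isNew-↑ʳ z′)
    crossing⇒Q : ∀ w z → T (glue B Q (w ↑ˡ N) (m ↑ʳ z)) ⊎ T (glue B Q (m ↑ʳ z) (w ↑ˡ N)) → Q z ≡ true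
    crossing⇒Q w z (inj₁ e) rewrite glue-↑ˡ↑ʳ w z = Equivalence.to T-≡ (proj₂ (T-∧⁻ (A (punchIn r′ w) r′) e))
    crossing⇒Q w z (inj₂ e) rewrite glue-↑ʳ↑ˡ z w = Equivalence.to T-≡ (proj₁ (T-∧⁻ (Q z) e))

    module GlueFVS {κ} {X : Vector Bool (m + N)} {Y : Vector Bool (suc m)}
                   (fvsY : IsFVSᵇ κ A Y) (fvsʳ : IsFVSᵇ κ B (X ∘ (m ↑ʳ_)))
                   (Y⊆X : removeAt Y r′ ⊆ᵇ (X ∘ (_↑ˡ N))) where

      private
        Avoids : Fin (m + N) → Set
        Avoids x = X x ≡ false

        collapse-avoids : ∀ x → Avoids x → isNew x ≡ true → Y (collapse x) ≡ false
        collapse-avoids x avoids new with splitView m x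
        ... | inˡ w rewrite collapse-↑ˡ w = ⊆ᵇ⇒∌ Y⊆X w avoids
        ... | inʳ z with () ← trans (sym new) (isNew-↑ʳ z)

      oldCycle⇒⊥ : ∀ c → Cycle κ (glue B Q) c → All Avoids c → All (λ x → isNew x ≡ false) c → ⊥
      oldCycle⇒⊥ c@(x ∷ _) cyc avoids olds with splitView m x
      ... | inˡ w  with () ← trans (sym (isNew-↑ˡ w)) (All.head olds)
      ... | inʳ z₀ = fvsʳ (map ρ c) (Cycle-map ρ P ρ-injective ρ-homomorphic κ c Pc cyc) (All.map⁺ (All.map ρ-avoids Pc))
        where
        ρ : Fin (m + N) → Fin N
        ρ x = [ const z₀ , id ]′ (splitAt m x)
        P = λ x → Avoids x × isNew x ≡ false
        Pc = All.zip (avoids , olds)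
        old-view : ∀ x → isNew x ≡ false → x ≡ m ↑ʳ ρ x
        old-view x old with splitView m x
        ... | inˡ w with () ← trans (sym (isNew-↑ˡ w)) old
        ... | inʳ z rewrite splitAt-↑ʳ m N z = refl
        ρ-injective : ∀ x y → P x → P y → ρ x ≡ ρ y → x ≡ y
        ρ-injective x y (_ , old-x) (_ , old-y) eq = trans (old-view x old-x) (trans (cong (m ↑ʳ_) eq) (sym (old-view y old-y)))
        ρ-homomorphic : ∀ x y → P x → P y → T (glue B Q x y) → T (B (ρ x) (ρ y))
        ρ-homomorphic x y (_ , old-x) (_ , old-y) e = subst T (glue-↑ʳ↑ʳ (ρ x) (ρ y))
          (subst₂ (λ x′ y′ → T (glue B Q x′ y′)) (old-view x old-x) (old-view y old-y) e)
        ρ-avoids : ∀ {x} → P x → X (m ↑ʳ ρ x) ≡ false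
        ρ-avoids {x} (avoids , old) = subst Avoids (old-view x old) avoids

      private
        sameSide : (∀ z → X (m ↑ʳ z) ≡ false → Q z ≡ false) → ∀ x xs → All Avoids (x ∷ xs) →
                   Cycle κ (glue B Q) (x ∷ xs) → All (λ y → isNew y ≡ isNew x) (x ∷ xs)
        sameSide separated x xs avoids (_ , _ , chain) =
          refl ∷ All.++⁻ˡ xs (sameSide-Chain x (xs ++ [ x ]) (All.++⁺ avoids (All.head avoids ∷ [])) chain)
          where
          edge-sameSide : ∀ x y → Avoids x → Avoids y → T (glue B Q x y) → isNew y ≡ isNew x
          edge-sameSide x y avoids-x avoids-y e with splitView m x | splitView m y
          ... | inˡ w | inˡ w′ = trans (isNew-↑ˡ w′) (sym (isNew-↑ˡ w))
          ... | inʳ z | inʳ z′ = trans (isNew-↑ʳ z′) (sym (isNew-↑ʳ z))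
          ... | inˡ w | inʳ z  with () ← trans (sym (crossing⇒Q w z (inj₁ e))) (separated z avoids-y)
          ... | inʳ z | inˡ w  with () ← trans (sym (crossing⇒Q w z (inj₂ e))) (separated z avoids-x)
          sameSide-Chain : ∀ x l → All Avoids (x ∷ l) → Chain (glue B Q) (x ∷ l) → All (λ y → isNew y ≡ isNew x) l
          sameSide-Chain x []      _                                _           = []
          sameSide-Chain x (y ∷ l) (avoids-x ∷ avoids-y ∷ avoids) (e , chain) =
            edge-sameSide x y avoids-x avoids-y e ∷
            All.map (λ eq → trans eq (edge-sameSide x y avoids-x avoids-y e)) (sameSide-Chain y l (avoids-y ∷ avoids) chain)

      -- Outside X no edge joins the two parts, so a cycle avoiding X stays in one of them.
      IsFVSᵇ-glue-separated : (∀ z → X (m ↑ʳ z) ≡ false → Q z ≡ false) → IsFVSᵇ κ (glue B Q) X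
      IsFVSᵇ-glue-separated separated c@(x ∷ xs) cyc avoids with isNew x in side
      ... | false = oldCycle⇒⊥ c cyc avoids (All.map (λ eq → trans eq side) (sameSide separated x xs avoids cyc))
      ... | true  = fvsY (map collapse c) (Cycle-map collapse P collapse-injective′ collapse-homomorphic′ κ c Pc cyc)
                         (All.map⁺ (All.map (λ (avoids , new) → collapse-avoids _ avoids new) Pc))
        where
        P = λ x → Avoids x × isNew x ≡ true
        Pc = All.zip (avoids , All.map (λ eq → trans eq side) (sameSide separated x xs avoids cyc))
        collapse-injective′ : ∀ x y → P x → P y → collapse x ≡ collapse y → x ≡ y
        collapse-injective′ x y (_ , new) _ = collapse-injective x y new
        collapse-homomorphic′ : ∀ x y → P x → P y → T (glue B Q x y) → T (A (collapse x) (collapse y))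
        collapse-homomorphic′ x y (_ , new) _ = collapse-homomorphic x y (inj₁ new)

      private
        module Cut (t : Fin N) (cut : ∀ z → X (m ↑ʳ z) ≡ false → Q z ≡ true → z ≡ t) where

          crossing⇒t : ∀ x y → Avoids y → isNew x ≡ true → isNew y ≡ false →
                       T (glue B Q x y) ⊎ T (glue B Q y x) → y ≡ m ↑ʳ t
          crossing⇒t x y avoids-y new-x old-y e with splitView m x | splitView m y
          ... | inˡ w | inʳ z  = cong (m ↑ʳ_) (cut z avoids-y (crossing⇒Q w z e))
          ... | inʳ z | _      with () ← trans (sym new-x) (isNew-↑ʳ z)
          ... | inˡ _ | inˡ w  with () ← trans (sym old-y) (isNew-↑ˡ w)

          forward : ∀ v ys x → All Avoids (v ∷ ys) → isNew v ≡ false → isNew x ≡ true →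
                    Chain (glue B Q) (v ∷ ys ++ [ x ]) → v ≡ m ↑ʳ t ⊎ m ↑ʳ t ∈ₗ ys
          forward v []       x (avoids-v ∷ _) old-v new-x (e , _) = inj₁ (crossing⇒t x v avoids-v new-x old-v (inj₂ e))
          forward v (y ∷ ys) x (avoids-v ∷ avoids) old-v new-x (e , chain) with isNew y in side-y
          ... | true  = inj₁ (crossing⇒t y v avoids-v side-y old-v (inj₂ e))
          ... | false = inj₂ ([ here ∘ sym , there ]′ (forward y ys x avoids side-y new-x chain))

          backward : ∀ a xs v → All Avoids (xs ++ [ v ]) → isNew a ≡ true → isNew v ≡ false →
                     Chain (glue B Q) (a ∷ xs ++ [ v ]) → v ≡ m ↑ʳ t ⊎ m ↑ʳ t ∈ₗ xs
          backward a []       v (avoids-v ∷ _) new-a old-v (e , _) = inj₁ (crossing⇒t a v avoids-v new-a old-v (inj₁ e))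
          backward a (y ∷ xs) v (avoids-y ∷ avoids) new-a old-v (e , chain) with isNew y in side-y
          ... | false = inj₂ (here (sym (crossing⇒t a y avoids-y new-a side-y (inj₁ e))))
          ... | true  = Sum.map₂ there (backward y xs v avoids side-y old-v chain)

          -- Both arcs of the cycle from the new vertex u to an old vertex v pass through t.
          old⇒t : ∀ u xs v ys → isNew u ≡ true → Cycle κ (glue B Q) (u ∷ xs ++ v ∷ ys) →
                  All Avoids (u ∷ xs ++ v ∷ ys) → isNew v ≡ false → v ≡ m ↑ʳ t
          old⇒t u xs v ys new-u (_ ∷ uniq , _ , chain) (_ ∷ avoids) old-v
            with forward v ys u (All.++⁻ʳ xs avoids) old-v new-u chain₂
               | backward u xs v (All.++⁺ (All.++⁻ˡ xs avoids) (All.head (All.++⁻ʳ xs avoids) ∷ [])) new-u old-v chain₁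
            where
            split = Chain-split u xs v (ys ++ [ u ]) (subst (Chain (glue B Q)) (cong (u ∷_) (++-assoc xs (v ∷ ys) [ u ])) chain)
            chain₁ = proj₁ split
            chain₂ = proj₂ split
          ... | inj₁ v≡t  | _          = v≡t
          ... | _         | inj₁ v≡t   = v≡t
          ... | inj₂ t∈ys | inj₂ t∈xs  = ⊥-elim (proj₂ (proj₂ (Unique-++⁻ xs (v ∷ ys) uniq)) t∈xs (there t∈ys))

          oldsAreT : ∀ u rest → isNew u ≡ true → Cycle κ (glue B Q) (u ∷ rest) → All Avoids (u ∷ rest) →
                     All (λ v → isNew v ≡ false → v ≡ m ↑ʳ t) (u ∷ rest)
          oldsAreT u rest new-u cyc avoids = (λ old-u → contradiction (trans (sym new-u) old-u) λ ()) ∷ All.tabulate old∈⇒t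
            where
            old∈⇒t : ∀ {v} → v ∈ₗ rest → isNew v ≡ false → v ≡ m ↑ʳ t
            old∈⇒t {v} v∈rest with ∈-∃++ v∈rest
            ... | xs , ys , refl = old⇒t u xs v ys new-u cyc avoids

      -- Outside X the two parts meet only in t, so collapsing the old part onto r′ maps a cycle avoiding X
      -- through the new part to a cycle of D avoiding Y.
      IsFVSᵇ-glue-cut : (∀ z → ¬ T (B z z)) → ∀ t → (∀ z → X (m ↑ʳ z) ≡ false → Q z ≡ true → z ≡ t) →
                        Y r′ ≡ false → IsFVSᵇ κ (glue B Q) X
      IsFVSᵇ-glue-cut irreflexiveB t cut Y∌r′ c cyc avoids with Any.any? (λ x → isNew x ≟ᵇ true) c
      ... | no  ¬new = oldCycle⇒⊥ c cyc avoids (All.map ¬-not (¬Any⇒All¬ c ¬new))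
      ... | yes new with find new
      ...   | u , u∈c , new-u with ∈-∃++ u∈c
      ...     | xs , ys , refl =
        fvsY (map collapse c′) (Cycle-map collapse P collapse-injective′ collapse-homomorphic′ κ c′ Pc cyc′)
             (All.map⁺ (All.map collapse-avoids′ Pc))
        where
        open Cut t cut
        c′ = u ∷ ys ++ xs
        cyc′ = Cycle-rotate xs u ys cyc
        avoids′ = All-rotate xs (u ∷ ys) avoids
        P = λ x → Avoids x × (isNew x ≡ false → x ≡ m ↑ʳ t)
        Pc = All.zip (avoids′ , oldsAreT u (ys ++ xs) new-u cyc′ avoids′)
        collapse-injective′ : ∀ x y → P x → P y → collapse x ≡ collapse y → x ≡ y
        collapse-injective′ x y (_ , x≡t) (_ , y≡t) eq with isNew x in side-x | isNew y in side-y
        ... | true  | _     = collapse-injective x y side-x eq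
        ... | _     | true  = sym (collapse-injective y x side-y (sym eq))
        ... | false | false = trans (x≡t refl) (sym (y≡t refl))
        collapse-homomorphic′ : ∀ x y → P x → P y → T (glue B Q x y) → T (A (collapse x) (collapse y))
        collapse-homomorphic′ x y (_ , x≡t) (_ , y≡t) e with isNew x in side-x | isNew y in side-y
        ... | true  | _     = collapse-homomorphic x y (inj₁ side-x) e
        ... | _     | true  = collapse-homomorphic x y (inj₂ side-y) e
        ... | false | false = ⊥-elim (irreflexiveB t (subst T (glue-↑ʳ↑ʳ t t)
                                (subst₂ (λ x′ y′ → T (glue B Q x′ y′)) (x≡t refl) (y≡t refl) e)))
        collapse-avoids′ : ∀ {x} → P x → Y (collapse x) ≡ false
        collapse-avoids′ {x} (avoids-x , x≡t) with isNew x in side-x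
        ... | true  = collapse-avoids x avoids-x side-x
        ... | false = trans (cong (Y ∘ collapse) (x≡t refl)) (trans (cong Y (collapse-↑ʳ t)) Y∌r′)

-- The paper's D_i is tower (suc i); towerR k is the copy of R in the top layer of tower k.

module Tower {m : ℕ} (A : Adj (suc m)) (r′ : Fin (suc m)) (R : Subset (suc m)) where

  open Glue A r′

  order : ℕ → ℕ
  order zero    = 1
  order (suc k) = m + order k

  order≡ : ∀ k → order k ≡ suc (k * m)
  order≡ zero    = refl
  order≡ (suc k) = trans (cong (m +_) (order≡ k)) (+-suc m (k * m))

  layerR : ∀ {N} → Vector Bool (m + N)
  layerR = removeAt (lookup R) r′ ⧺ const false

  layerR-↑ˡ : ∀ {N} w → layerR {N} (w ↑ˡ N) ≡ lookup R (punchIn r′ w)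
  layerR-↑ˡ w = lookup-++ˡ (removeAt (lookup R) r′) (const false) w

  layerR-↑ʳ : ∀ {N} z → layerR {N} (m ↑ʳ z) ≡ false
  layerR-↑ʳ z = lookup-++ʳ (removeAt (lookup R) r′) (const false) z

  towerR : ∀ k → Vector Bool (order k)
  towerR zero    = const true
  towerR (suc k) = layerR

  tower : ∀ k → Adj (order k)
  tower zero    = λ _ _ → false
  tower (suc k) = glue (tower k) (towerR k)

  tower-isGraph : ∀ κ → IsGraph κ A → ∀ k → IsGraph κ (tower k)
  tower-isGraph undirected _ zero    = (λ _ ()) , (λ _ _ → refl)
  tower-isGraph directed   _ zero    = (λ _ ()) , (λ _ _ ())
  tower-isGraph κ isGraphA (suc k) = Glued.glue-isGraph (tower k) (towerR k) κ isGraphA (tower-isGraph κ isGraphA k)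

  module LowerBound {κ f} (fN : FVSNumber κ A f) (irreflexiveA : ∀ v → ¬ T (A v v))
                    (bad : IsBad κ A R) (r′∉R : r′ ∉ R) where

    private
      -- Either some vertex of Q outside X stands in for r′, or Q ⊆ X and r′ counts as deleted.
      anchor : ∀ {N ℓ} {B : Adj N} {Q X} → IsFVSᵇ κ (glue B Q) X →
               ℓ ≤ count (X ∘ (m ↑ʳ_)) → (Q ⊆ᵇ (X ∘ (m ↑ʳ_)) → suc ℓ ≤ count (X ∘ (m ↑ʳ_))) →
               Σ Bool λ b → IsFVSᵇ κ A (insertAt (X ∘ (_↑ˡ N)) r′ b) × ℓ + bit b ≤ count (X ∘ (m ↑ʳ_))
      anchor {N} {ℓ} {B} {Q} {X} fvs lb lb-cover with any? (λ z → (Q z ≟ᵇ true) ×-dec (X (m ↑ʳ z) ≟ᵇ false))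
      ... | yes (z , Qz , Xz) =
        false , Glued.IsFVSᵇ-restrictˡ B Q irreflexiveA fvs z false (λ _ → Qz , Xz) ,
        subst (_≤ count (X ∘ (m ↑ʳ_))) (sym (+-identityʳ ℓ)) lb
      ... | no  Q⊈X =
        true , Glued.IsFVSᵇ-restrictˡ B Q irreflexiveA fvs z true (λ ()) ,
        subst (_≤ count (X ∘ (m ↑ʳ_))) (+-comm 1 ℓ) lb′
        where
        Q⊆X : Q ⊆ᵇ (X ∘ (m ↑ʳ_))
        Q⊆X z Qz with X (m ↑ʳ z) in Xz
        ... | true  = refl
        ... | false = ⊥-elim (Q⊈X (z , Qz , Xz))
        lb′ = lb-cover Q⊆X
        z = proj₁ (0<count⇒∃true (X ∘ (m ↑ʳ_)) (≤-trans (s≤s z≤n) lb′))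

    glue-lowerBounds : ∀ {N ℓ} {B : Adj N} {Q X} → IsFVSᵇ κ (glue B Q) X →
                       ℓ ≤ count (X ∘ (m ↑ʳ_)) → (Q ⊆ᵇ (X ∘ (m ↑ʳ_)) → suc ℓ ≤ count (X ∘ (m ↑ʳ_))) →
                       f + ℓ ≤ count X × (layerR ⊆ᵇ X → suc (f + ℓ) ≤ count X)
    glue-lowerBounds {N} {ℓ} {B} {Q} {X} fvs lb lb-cover =
      bound (FVSNumber⇒≤count fN fvsY) , λ cover → bound (IsBad⇒<count bad fN fvsY (R⊆Y cover))
      where
      Xˡ = X ∘ (_↑ˡ N)
      Xʳ = X ∘ (m ↑ʳ_)
      b = proj₁ (anchor fvs lb lb-cover)
      Y = insertAt Xˡ r′ b
      fvsY = proj₁ (proj₂ (anchor fvs lb lb-cover))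
      ℓ+b≤ = proj₂ (proj₂ (anchor fvs lb lb-cover))
      bound : ∀ {g} → g ≤ count Y → g + ℓ ≤ count X
      bound {g} g≤ = begin
        g + ℓ                    ≤⟨ +-monoˡ-≤ ℓ g≤ ⟩
        count Y + ℓ              ≡⟨ cong (_+ ℓ) (count-insertAt Xˡ r′ b) ⟩
        bit b + count Xˡ + ℓ     ≡⟨ cong (_+ ℓ) (+-comm (bit b) (count Xˡ)) ⟩
        count Xˡ + bit b + ℓ     ≡⟨ +-assoc (count Xˡ) (bit b) ℓ ⟩
        count Xˡ + (bit b + ℓ)   ≡⟨ cong (count Xˡ +_) (+-comm (bit b) ℓ) ⟩
        count Xˡ + (ℓ + bit b)   ≤⟨ +-monoʳ-≤ (count Xˡ) ℓ+b≤ ⟩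
        count Xˡ + count Xʳ      ≡⟨ count-splitAt m X ⟨
        count X                  ∎
        where open ≤-Reasoning
      R⊆Y : layerR ⊆ᵇ X → ∀ v → v ∈ R → Y v ≡ true
      R⊆Y cover v v∈R with punchInView r′ v
      ... | at        = ⊥-elim (r′∉R v∈R)
      ... | punched w = trans (insertAt-punchIn Xˡ r′ b w)
                              (cover (w ↑ˡ N) (trans (layerR-↑ˡ w) ([]=⇒lookup v∈R)))

    lowerBounds : ∀ k X → IsFVSᵇ κ (tower k) X → k * f ≤ count X × (towerR k ⊆ᵇ X → suc (k * f) ≤ count X)
    lowerBounds zero    X _   = z≤n , λ cover → subst (λ b → 1 ≤ bit b + 0) (sym (cover zero refl)) ≤-refl
    lowerBounds (suc k) X fvs = glue-lowerBounds fvs (proj₁ bounds) (proj₂ bounds)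
      where bounds = lowerBounds k (X ∘ (m ↑ʳ_)) (Glued.IsFVSᵇ-restrictʳ (tower k) (towerR k) fvs)

  module UpperBound {κ f} (isGraphA : IsGraph κ A) (r′∉R : r′ ∉ R) {r₂ : Fin (suc m)} (r₂∈R : r₂ ∈ R)
                    {Y : Vector Bool (suc m)} (fvsY : IsFVSᵇ κ A Y) (count-Y : count Y ≡ f)
                    (R⊆Y : ∀ v → v ∈ R → v ≢ r₂ → Y v ≡ true) (Y∌r₂ : Y r₂ ≡ false) where

    private
      irreflexive-tower : ∀ k z → ¬ T (tower k z z)
      irreflexive-tower k = IsGraph⇒irreflexive (tower-isGraph κ isGraphA k)

    module WhenR′∉Y (Y∌r′ : Y r′ ≡ false) where

      stack : ∀ k → Vector Bool (order k)
      stack zero    = const false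
      stack (suc k) = removeAt Y r′ ⧺ stack k

      count-stack : ∀ k → count (stack k) ≡ k * f
      count-stack zero    = refl
      count-stack (suc k) = trans (count-++ (removeAt Y r′) (stack k))
                                  (cong₂ _+_ (trans (count-removeAt-false Y r′ Y∌r′) count-Y) (count-stack k))

      r′≢r₂ : r′ ≢ r₂
      r′≢r₂ r′≡r₂ = r′∉R (subst (_∈ R) (sym r′≡r₂) r₂∈R)

      -- The copy of r₂ in the newest layer: the only vertex of that copy of R outside the stack.
      top : ∀ k → Fin (order k)
      top zero    = zero
      top (suc k) = punchOut r′≢r₂ ↑ˡ order k

      stack-invariant : ∀ k → IsFVSᵇ κ (tower k) (stack k) × (∀ z → stack k z ≡ false → towerR k z ≡ true → z ≡ top k)
      stack-invariant zero    = IsFVSᵇ-edgeless , λ { zero _ _ → refl }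
      stack-invariant (suc k) = fvs , onlyTop
        where
        open Glued (tower k) (towerR k)
        fvs-k = proj₁ (stack-invariant k)
        onlyTop-k = proj₂ (stack-invariant k)
        Y⊆stack : removeAt Y r′ ⊆ᵇ (stack (suc k) ∘ (_↑ˡ order k))
        Y⊆stack w Yw = trans (lookup-++ˡ (removeAt Y r′) (stack k) w) Yw
        fvs = GlueFVS.IsFVSᵇ-glue-cut fvsY (IsFVSᵇ-cong (λ z → sym (lookup-++ʳ (removeAt Y r′) (stack k) z)) fvs-k) Y⊆stack
                (irreflexive-tower k) (top k) (λ z → onlyTop-k z ∘ trans (sym (lookup-++ʳ (removeAt Y r′) (stack k) z))) Y∌r′
        onlyTop : ∀ x → stack (suc k) x ≡ false → layerR x ≡ true → x ≡ top (suc k)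
        onlyTop x stack∌x R∋x with splitView m x
        ... | inʳ z = contradiction (trans (sym R∋x) (layerR-↑ʳ z)) λ ()
        ... | inˡ w with punchIn r′ w ≟ r₂
        ...   | yes w↦r₂ = cong (_↑ˡ order k) (punchIn-injective r′ w _ (trans w↦r₂ (sym (punchIn-punchOut r′≢r₂))))
        ...   | no  w↛r₂ = contradiction (trans (sym Y∋w) (trans (sym (lookup-++ˡ (removeAt Y r′) (stack k) w)) stack∌x)) λ ()
          where Y∋w = R⊆Y _ (lookup⇒[]= _ R (trans (sym (layerR-↑ˡ w)) R∋x)) w↛r₂

      upperBound : ∀ i → Σ (Vector Bool (order (suc i))) λ X → IsFVSᵇ κ (tower (suc i)) X × count X ≡ f + i * f
      upperBound i = stack (suc i) , proj₁ (stack-invariant (suc i)) , count-stack (suc i)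

    module WhenR′∈Y (Y∋r′ : Y r′ ≡ true) where

      Y₂ : Vector Bool (suc m)
      Y₂ = insertAt (removeAt Y r₂) r₂ true

      Y⊆Y₂ : Y ⊆ᵇ Y₂
      Y⊆Y₂ v Yv with punchInView r₂ v
      ... | at        = insertAt-lookup (removeAt Y r₂) r₂ true
      ... | punched j = trans (insertAt-punchIn (removeAt Y r₂) r₂ true j) Yv

      R⊆Y₂ : ∀ v → v ∈ R → Y₂ v ≡ true
      R⊆Y₂ v v∈R with punchInView r₂ v
      ... | at        = insertAt-lookup (removeAt Y r₂) r₂ true
      ... | punched j = trans (insertAt-punchIn (removeAt Y r₂) r₂ true j) (R⊆Y _ v∈R (punchInᵢ≢i r₂ j))

      count-Y₂ : count Y₂ ≡ suc f
      count-Y₂ = trans (count-insertAt (removeAt Y r₂) r₂ true) (cong suc (trans (count-removeAt-false Y r₂ Y∌r₂) count-Y))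

      stack : ∀ k → Vector Bool (order k)
      stack zero    = const true
      stack (suc k) = removeAt Y₂ r′ ⧺ stack k

      count-stack : ∀ k → count (stack k) ≡ suc (k * f)
      count-stack zero    = refl
      count-stack (suc k) = begin
        count (removeAt Y₂ r′ ⧺ stack k)        ≡⟨ count-++ (removeAt Y₂ r′) (stack k) ⟩
        count (removeAt Y₂ r′) + count (stack k) ≡⟨ cong₂ _+_ count-layer (count-stack k) ⟩
        f + suc (k * f)                          ≡⟨ +-suc f (k * f) ⟩
        suc (f + k * f)                          ∎
        where
        open ≡-Reasoning
        count-layer : count (removeAt Y₂ r′) ≡ f
        count-layer = suc-injective (trans (count-removeAt-true Y₂ r′ (Y⊆Y₂ r′ Y∋r′)) count-Y₂)

      stack-invariant : ∀ k → IsFVSᵇ κ (tower k) (stack k) × towerR k ⊆ᵇ stack k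

      -- Since the stack contains the copy of R in layer k, layer k+1 is separated from the layers below.
      glue-onto-stack : ∀ k {Z} → Y ⊆ᵇ Z → IsFVSᵇ κ (tower (suc k)) (removeAt Z r′ ⧺ stack k)
      glue-onto-stack k {Z} Y⊆Z = GlueFVS.IsFVSᵇ-glue-separated fvsY
        (IsFVSᵇ-cong (λ z → sym (lookup-++ʳ (removeAt Z r′) (stack k) z)) (proj₁ (stack-invariant k)))
        (λ w Yw → trans (lookup-++ˡ (removeAt Z r′) (stack k) w) (Y⊆Z _ Yw))
        (λ z → ⊆ᵇ⇒∌ (proj₂ (stack-invariant k)) z ∘ trans (sym (lookup-++ʳ (removeAt Z r′) (stack k) z)))
        where open Glued (tower k) (towerR k)

      stack-invariant zero    = IsFVSᵇ-edgeless , λ _ _ → refl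
      stack-invariant (suc k) = glue-onto-stack k Y⊆Y₂ , R⊆stack
        where
        R⊆stack : layerR ⊆ᵇ stack (suc k)
        R⊆stack x R∋x with splitView m x
        ... | inʳ z = contradiction (trans (sym R∋x) (layerR-↑ʳ z)) λ ()
        ... | inˡ w = trans (lookup-++ˡ (removeAt Y₂ r′) (stack k) w)
                            (R⊆Y₂ _ (lookup⇒[]= _ R (trans (sym (layerR-↑ˡ w)) R∋x)))

      upperBound : ∀ i → Σ (Vector Bool (order (suc i))) λ X → IsFVSᵇ κ (tower (suc i)) X × count X ≡ f + i * f
      upperBound i = removeAt Y r′ ⧺ stack i , glue-onto-stack i (λ _ → id) , (begin
        count (removeAt Y r′ ⧺ stack i)          ≡⟨ count-++ (removeAt Y r′) (stack i) ⟩
        count (removeAt Y r′) + count (stack i)  ≡⟨ cong (count (removeAt Y r′) +_) (count-stack i) ⟩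
        count (removeAt Y r′) + suc (i * f)      ≡⟨ +-suc (count (removeAt Y r′)) (i * f) ⟩
        suc (count (removeAt Y r′)) + i * f      ≡⟨ cong (_+ i * f) (trans (count-removeAt-true Y r′ Y∋r′) count-Y) ⟩
        f + i * f                                ∎)
        where open ≡-Reasoning

    upperBound : ∀ i → Σ (Vector Bool (order (suc i))) λ X → IsFVSᵇ κ (tower (suc i)) X × count X ≡ f + i * f
    upperBound i with Y r′ in Y-r′
    ... | false = WhenR′∉Y.upperBound Y-r′ i
    ... | true  = WhenR′∈Y.upperBound Y-r′ i

  module DegeneracyBound (R-nonempty : 1 ≤ ∣ R ∣) (r′∉R : r′ ∉ R) {d} {φ : Permutation′ (∣ R ∣ + m)}
                         (S-last : IsSLast (blowSet {suc m} ∣ R ∣) φ)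
                         (elim : IsElimOrdering (blowUp A r′ ∣ R ∣) d φ) where

    private
      M = ∣ R ∣
      blown = blowUp A r′ M

      blowS-↑ˡ : ∀ j → blowS {suc m} M (j ↑ˡ m) ≡ true
      blowS-↑ˡ j rewrite splitAt-↑ˡ M j m = refl

      blowS-↑ʳ : ∀ w → blowS {suc m} M (M ↑ʳ w) ≡ false
      blowS-↑ʳ w rewrite splitAt-↑ʳ M m w = refl

      blowOrig-↑ˡ : ∀ j → blowOrig {suc m} M r′ (j ↑ˡ m) ≡ r′
      blowOrig-↑ˡ j rewrite splitAt-↑ˡ M j m = refl

      blowOrig-↑ʳ : ∀ w → blowOrig {suc m} M r′ (M ↑ʳ w) ≡ punchIn r′ w
      blowOrig-↑ʳ w rewrite splitAt-↑ʳ M m w = refl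

      blowUp-outsideS : ∀ x y → blowS {suc m} M x ≡ false ⊎ blowS {suc m} M y ≡ false →
                        blown x y ≡ A (blowOrig M r′ x) (blowOrig M r′ y)
      blowUp-outsideS x y outside with blowS {suc m} M x | blowS {suc m} M y
      blowUp-outsideS x y (inj₁ ()) | true  | true
      blowUp-outsideS x y (inj₂ ()) | true  | true
      ... | true  | false = refl
      ... | false | true  = refl
      ... | false | false = refl

      blowUp-↑ʳ↑ʳ : ∀ w w′ → blown (M ↑ʳ w) (M ↑ʳ w′) ≡ A (punchIn r′ w) (punchIn r′ w′)
      blowUp-↑ʳ↑ʳ w w′
        rewrite blowUp-outsideS (M ↑ʳ w) (M ↑ʳ w′) (inj₁ (blowS-↑ʳ w)) | blowOrig-↑ʳ w | blowOrig-↑ʳ w′ = refl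

      blowUp-↑ˡ↑ʳ : ∀ j w → blown (j ↑ˡ m) (M ↑ʳ w) ≡ A r′ (punchIn r′ w)
      blowUp-↑ˡ↑ʳ j w
        rewrite blowUp-outsideS (j ↑ˡ m) (M ↑ʳ w) (inj₂ (blowS-↑ʳ w)) | blowOrig-↑ˡ j | blowOrig-↑ʳ w = refl

      blowUp-↑ʳ↑ˡ : ∀ w j → blown (M ↑ʳ w) (j ↑ˡ m) ≡ A (punchIn r′ w) r′
      blowUp-↑ʳ↑ˡ w j
        rewrite blowUp-outsideS (M ↑ʳ w) (j ↑ˡ m) (inj₁ (blowS-↑ʳ w)) | blowOrig-↑ˡ j | blowOrig-↑ʳ w = refl

      φℕ : Fin (M + m) → ℕ
      φℕ = toℕ ∘ (φ ⟨$⟩ʳ_)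

      φℕ-injective : ∀ x y → φℕ x ≡ φℕ y → x ≡ y
      φℕ-injective x y eq = trans (sym (inverseˡ φ)) (trans (cong (φ ⟨$⟩ˡ_) (toℕ-injective eq)) (inverseˡ φ))

    base : ℕ → ℕ
    base zero    = 1
    base (suc k) = base k + (M + m)

    label : ∀ k → Fin (order k) → ℕ
    label zero    = const 0
    label (suc k) = (λ w → base k + φℕ (M ↑ʳ w)) ⧺ label k

    label-↑ˡ : ∀ k w → label (suc k) (w ↑ˡ order k) ≡ base k + φℕ (M ↑ʳ w)
    label-↑ˡ k = lookup-++ˡ (λ w → base k + φℕ (M ↑ʳ w)) (label k)

    label-↑ʳ : ∀ k z → label (suc k) (m ↑ʳ z) ≡ label k z
    label-↑ʳ k = lookup-++ʳ (λ w → base k + φℕ (M ↑ʳ w)) (label k)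

    label<base : ∀ k z → label k z < base k
    label<base zero    _ = s≤s z≤n
    label<base (suc k) x with splitView m x
    ... | inˡ w = subst (_< base (suc k)) (sym (label-↑ˡ k w)) (+-monoʳ-< (base k) (toℕ<n _))
    ... | inʳ z = subst (_< base (suc k)) (sym (label-↑ʳ k z)) (<-≤-trans (label<base k z) (m≤m+n (base k) _))

    old<new : ∀ k z w → label (suc k) (m ↑ʳ z) < label (suc k) (w ↑ˡ order k)
    old<new k z w = subst₂ _<_ (sym (label-↑ʳ k z)) (sym (label-↑ˡ k w)) (<-≤-trans (label<base k z) (m≤m+n (base k) _))

    label-injective : ∀ k u v → label k u ≡ label k v → u ≡ v
    label-injective zero    zero zero _  = refl
    label-injective (suc k) u    v    eq with splitView m u | splitView m v
    ... | inˡ w | inˡ w′ = cong (_↑ˡ order k) (↑ʳ-injective M w w′ (φℕ-injective _ _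
                             (+-cancelˡ-≡ (base k) _ _ (trans (sym (label-↑ˡ k w)) (trans eq (label-↑ˡ k w′))))))
    ... | inˡ w | inʳ z  = contradiction (sym eq) (<⇒≢ (old<new k z w))
    ... | inʳ z | inˡ w  = contradiction eq (<⇒≢ (old<new k z w))
    ... | inʳ z | inʳ z′ = cong (m ↑ʳ_) (label-injective k z z′ (trans (sym (label-↑ʳ k z)) (trans eq (label-↑ʳ k z′))))

    count-towerR : ∀ k → count (towerR k) ≤ M
    count-towerR zero    = R-nonempty
    count-towerR (suc k) = ≤-reflexive (begin
      count (removeAt (lookup R) r′ ⧺ const false)                   ≡⟨ count-++ (removeAt (lookup R) r′) (const false) ⟩
      count (removeAt (lookup R) r′) + count {order k} (const false) ≡⟨ cong₂ _+_ count-R (count-false {order k}) ⟩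
      count (lookup R) + 0                                           ≡⟨ +-identityʳ _ ⟩
      count (lookup R)                                               ≡⟨ ∣p∣≡count R ⟨
      M                                                              ∎)
      where
      open ≡-Reasoning
      count-R = count-removeAt-false (lookup R) r′ (∉⇒lookup≡false r′∉R)

    private
      E : ∀ k → Fin (order k) → Vector Bool (order k)
      E k = earlierᵇ (tower k) (label k)

      Eᵇ : Fin (M + m) → Vector Bool (M + m)
      Eᵇ = earlierᵇ blown φℕ

      -- An old vertex has no earlier neighbour in the new layer.
      earlier-old : ∀ k z → count (E (suc k) (m ↑ʳ z)) ≡ count (E k z)
      earlier-old k z = begin
        count (E (suc k) (m ↑ʳ z))
          ≡⟨ count-splitAt m (E (suc k) (m ↑ʳ z)) ⟩
        count (E (suc k) (m ↑ʳ z) ∘ (_↑ˡ order k)) + count (E (suc k) (m ↑ʳ z) ∘ (m ↑ʳ_))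
          ≡⟨ cong₂ _+_ (count-cong new-later) (count-cong old-same) ⟩
        count {m} (const false) + count (E k z)
          ≡⟨ cong (_+ count (E k z)) (count-false {m}) ⟩
        count (E k z)
          ∎
        where
        open ≡-Reasoning
        open Glued (tower k) (towerR k)
        new-later : ∀ w → E (suc k) (m ↑ʳ z) (w ↑ˡ order k) ≡ false
        new-later w = trans (cong (und (tower (suc k)) (w ↑ˡ order k) (m ↑ʳ z) ∧_)
                                  (isYes-false (label (suc k) (w ↑ˡ order k) <? label (suc k) (m ↑ʳ z)) (<⇒≯ (old<new k z w))))
                            (∧-zeroʳ _)
        old-same : ∀ z′ → E (suc k) (m ↑ʳ z) (m ↑ʳ z′) ≡ E k z z′
        old-same z′ rewrite glue-↑ʳ↑ʳ z′ z | glue-↑ʳ↑ʳ z z′ | label-↑ʳ k z | label-↑ʳ k z′ = refl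

      -- A new vertex sees its layer as its copy in D_{r′×|R|} does, and at most |R| earlier vertices below,
      -- all adjacent to it exactly when r′ is adjacent to it in D, like the vertices of S.
      earlier-new : ∀ k w → count (E (suc k) (w ↑ˡ order k)) ≤ d
      earlier-new k w = begin
        count (E (suc k) v)
          ≡⟨ count-splitAt m (E (suc k) v) ⟩
        count (E (suc k) v ∘ (_↑ˡ order k)) + count (E (suc k) v ∘ (m ↑ʳ_))
          ≤⟨ +-mono-≤ (≤-reflexive (count-cong layer-same)) below-bound ⟩
        count (Eᵇ v′ ∘ (M ↑ʳ_)) + count {M} (const c)
          ≡⟨ +-comm _ (count {M} (const c)) ⟩
        count {M} (const c) + count (Eᵇ v′ ∘ (M ↑ʳ_))
          ≡⟨ cong (_+ count (Eᵇ v′ ∘ (M ↑ʳ_))) (count-cong S-earlier) ⟨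
        count (Eᵇ v′ ∘ (_↑ˡ m)) + count (Eᵇ v′ ∘ (M ↑ʳ_))
          ≡⟨ count-splitAt M (Eᵇ v′) ⟨
        count (Eᵇ v′)
          ≤⟨ IsElimOrdering⇒count≤ {G = blown} {φ = φ} elim v′ ⟩
        d
          ∎
        where
        open ≤-Reasoning
        open Glued (tower k) (towerR k)
        v = w ↑ˡ order k
        v′ = M ↑ʳ w
        c = und A r′ (punchIn r′ w)
        layer-same : ∀ w′ → E (suc k) v (w′ ↑ˡ order k) ≡ Eᵇ v′ (M ↑ʳ w′)
        layer-same w′
          rewrite glue-↑ˡ↑ˡ w′ w | glue-↑ˡ↑ˡ w w′ | blowUp-↑ʳ↑ʳ w′ w | blowUp-↑ʳ↑ʳ w w′ | label-↑ˡ k w | label-↑ˡ k w′ =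
          cong (und A (punchIn r′ w′) (punchIn r′ w) ∧_) (isYes-⇔ _ _ (+-cancelˡ-< (base k) _ _) (+-monoʳ-< (base k)))
        adjacent-below : ∀ z → und (tower (suc k)) (m ↑ʳ z) v ≡ (towerR k z ∧ c)
        adjacent-below z rewrite glue-↑ʳ↑ˡ z w | glue-↑ˡ↑ʳ w z =
          trans (cong ((towerR k z ∧ A r′ (punchIn r′ w)) ∨_) (∧-comm (A (punchIn r′ w) r′) (towerR k z)))
                (sym (∧-distribˡ-∨ (towerR k z) _ _))
        below-bound : count (E (suc k) v ∘ (m ↑ʳ_)) ≤ count {M} (const c)
        below-bound = ≤-trans
          (count-mono λ z e → subst T (adjacent-below z) (proj₁ (T-∧⁻ (und (tower (suc k)) (m ↑ʳ z) v) e)))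
          (count-∧ʳ (towerR k) c (count-towerR k))
        S-before-v′ : ∀ j → φℕ (j ↑ˡ m) < φℕ v′
        S-before-v′ j = S-last (j ↑ˡ m) v′
          (lookup⇒[]= (j ↑ˡ m) (blowSet {suc m} M) (trans (lookup∘tabulate (blowS {suc m} M) (j ↑ˡ m)) (blowS-↑ˡ j)))
          (lookup≡false⇒∉ (trans (lookup∘tabulate (blowS {suc m} M) v′) (blowS-↑ʳ w)))
        S-earlier : ∀ j → Eᵇ v′ (j ↑ˡ m) ≡ c
        S-earlier j rewrite blowUp-↑ˡ↑ʳ j w | blowUp-↑ʳ↑ˡ w j | isYes-true (φℕ (j ↑ˡ m) <? φℕ v′) (S-before-v′ j) =
          ∧-identityʳ c

    earlier≤d : ∀ k v → count (E k v) ≤ d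
    earlier≤d zero    _ = z≤n
    earlier≤d (suc k) x with splitView m x
    ... | inˡ w = earlier-new k w
    ... | inʳ z = subst (_≤ d) (sym (earlier-old k z)) (earlier≤d k z)

    tower-elimOrdering : ∀ k → Σ (Permutation′ (order k)) (IsElimOrdering (tower k) d)
    tower-elimOrdering k = labelling⇒ElimOrdering {G = tower k} (label k) (label-injective k) (earlier≤d k)

  FVSNumber-tower-≥ : ∀ {κ f} → IsGraph κ A → FVSNumber κ A f → IsBad κ A R → r′ ∉ R →
                      ∀ i {fᵢ} → FVSNumber κ (tower (suc i)) fᵢ → f + i * f ≤ fᵢ
  FVSNumber-tower-≥ isGraphA fN bad r′∉R i = ≤FVSNumber λ X fvs →
    proj₁ (LowerBound.lowerBounds fN (IsGraph⇒irreflexive isGraphA) bad r′∉R (suc i) X fvs)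

  FVSNumber-tower-≤ : ∀ {κ f} → IsGraph κ A → FVSNumber κ A f → IsBad κ A R → r′ ∉ R → ∀ {r₂} → r₂ ∈ R →
                      ∀ {Y} → IsMinFVS κ A Y → R - r₂ ⊆ Y →
                      ∀ i {fᵢ} → FVSNumber κ (tower (suc i)) fᵢ → fᵢ ≤ f + i * f
  FVSNumber-tower-≤ isGraphA fN bad r′∉R {r₂} r₂∈R {Y} minY R-r₂⊆Y i fᵢN with lookup Y r₂ in Y-r₂
  ... | true  = contradiction (Y , minY , λ {v} → R⊆Y {v}) bad
    where
    R⊆Y : R ⊆ Y
    R⊆Y {v} v∈R with v ≟ r₂
    ... | yes refl = lookup⇒[]= v Y Y-r₂
    ... | no  v≢r₂ = R-r₂⊆Y (x∈p∧x≢y⇒x∈p-y v∈R v≢r₂)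
  ... | false = subst (_ ≤_) count-X (FVSNumber⇒≤count fᵢN fvs-X)
    where
    R⊆Y+r₂ : ∀ v → v ∈ R → v ≢ r₂ → lookup Y v ≡ true
    R⊆Y+r₂ v v∈R v≢r₂ = []=⇒lookup (R-r₂⊆Y (x∈p∧x≢y⇒x∈p-y v∈R v≢r₂))
    count-Y = trans (sym (∣p∣≡count Y)) (IsMinFVS⇒∣∣≡ fN minY)
    open UpperBound isGraphA r′∉R r₂∈R (IsFVS⇒IsFVSᵇ (proj₁ minY)) count-Y R⊆Y+r₂ Y-r₂
    fvs-X = proj₁ (proj₂ (upperBound i))
    count-X = proj₂ (proj₂ (upperBound i))

  Degeneracy-tower-≤ : ∀ {κ f} → FVSNumber κ A f → IsBad κ A R → r′ ∉ R →
                       ∀ i {d dRL} → Degeneracy (tower (suc i)) d → RLDegeneracy A R r′ dRL → d ≤ dRL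
  Degeneracy-tower-≤ fN bad r′∉R i {dRL = dRL} (_ , least) ((φ , S-last , elim) , _) =
    least dRL (DegeneracyBound.tower-elimOrdering R-nonempty r′∉R {φ = φ} S-last elim (suc i))
    where
    R-nonempty : 1 ≤ ∣ R ∣
    R-nonempty = ≤-trans (s≤s z≤n) (x∈p⇒∣p-x∣<∣p∣ (proj₂ (IsBad⇒Nonempty bad fN)))

proposition3p2 : (κ : Kind) (n : ℕ) (D : Adj n) → IsGraph κ D →
    (f : ℕ) → FVSNumber κ D f →
    (R : Subset n) → IsBad κ D R →
    (r′ : Fin n) → r′ ∉ R →
    Σ (ℕ → Σ ℕ Adj) λ Ds → (i : ℕ) →
      IsGraph κ (proj₂ (Ds i))
      × proj₁ (Ds i) ≡ n + i * (n ∸ 1)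
      × (∀ fᵢ → FVSNumber κ (proj₂ (Ds i)) fᵢ → f + i * f ≤ fᵢ)
      × (IsMinimalBad κ D R → ∀ fᵢ → FVSNumber κ (proj₂ (Ds i)) fᵢ → fᵢ ≡ f + i * f)
      × (∀ d dRL → Degeneracy (proj₂ (Ds i)) d → RLDegeneracy D R r′ dRL → d ≤ dRL)
proposition3p2 κ zero    D _        f fN R bad () _
proposition3p2 κ (suc m) D isGraphD f fN R bad r′ r′∉R = (λ i → order (suc i) , tower (suc i)) , λ i →
  tower-isGraph κ isGraphD (suc i) ,
  order≡ (suc i) ,
  (λ _ → FVSNumber-tower-≥ isGraphD fN bad r′∉R i) ,
  (λ minimalBad fᵢ fᵢN → ≤-antisym (upper minimalBad i fᵢN) (FVSNumber-tower-≥ isGraphD fN bad r′∉R i fᵢN)) ,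
  (λ _ _ → Degeneracy-tower-≤ fN bad r′∉R i)
  where
  open Tower D r′ R
  r₂ = proj₁ (IsBad⇒Nonempty bad fN)
  r₂∈R = proj₂ (IsBad⇒Nonempty bad fN)
  -- R − r₂ is not bad, so it lies in some minimum FVS; the goal being decidable, we may assume one.
  upper : IsMinimalBad κ D R → ∀ i {fᵢ} → FVSNumber κ (tower (suc i)) fᵢ → fᵢ ≤ f + i * f
  upper (_ , minimal) i {fᵢ} fᵢN = decidable-stable (fᵢ ≤? f + i * f) λ fᵢ≰ →
    minimal (R - r₂) (x∈p⇒p-x⊂p r₂∈R) λ (Y , minY , R-r₂⊆Y) →
      fᵢ≰ (FVSNumber-tower-≤ isGraphD fN bad r′∉R r₂∈R minY R-r₂⊆Y i fᵢN)
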